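{- Consider the Game of Cards with $p$ players and $n=kp$ cards, let $O$ be an initial configuration, and let $P=(k,\dots,k)$. Then every maximal sequence of moves starting from $O$ is finite and has length $$t=p\cdot\Big(-\min_{1\le i\le p} d_i(O,P)\Big)+\sum_{i=1}^{p} d_i(O,P).$$
   Context: Game of Cards: $p$ players sit in a cycle; indices are taken modulo $p$ (player $p$'s right neighbor is player $1$). A configuration is a vector $(a_1,\dots,a_p)$ of nonnegative integers with sum $n$. A move at position $i$ is allowed in $a$ iff $a_i>a_{i+1}$ (with $a_{p+1}=a_1$); it replaces $a_i$ by $a_i-1$ and $a_{i+1}$ by $a_{i+1}+1$. The game ends when no move is allowed. For configurations $a,b$, $d(a,b)\in\mathbb Z^p$ is defined by $d_j(a,b)=\sum_{i=1}^{j}(a_i-b_i)$ for $j=1,\dots,p$ (so $d_p(a,b)=0$). -}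

module Defs where

open import Data.Nat using (ℕ; zero; suc; _<_; _≤_; _∸_; _+_; _%_)
open import Data.Nat.DivMod using (m%n<n)
open import Data.Integer as ℤ using (ℤ; +_; _-_; _⊓_)
open import Data.Fin using (Fin; toℕ; fromℕ<; _≟_)
import Data.Fin as Fin
open import Data.List using (List; []; _∷_; map; take; foldr; allFin)
open import Data.Product using (_×_)
open import Data.Unit using (⊤)
open import Relation.Nullary using (yes; no)

Config : ℕ → Set
Config p = Fin p → ℕ

next : ∀ {q} → Fin (suc q) → Fin (suc q)
next {q} i = fromℕ< (m%n<n (suc (toℕ i)) (suc q))

Allowed : ∀ {q} → Config (suc q) → Fin (suc q) → Set
Allowed a i = a (next i) < a i

move : ∀ {q} → Config (suc q) → Fin (suc q) → Config (suc q)
move a i j with j ≟ i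
... | yes _ = a i ∸ 1
... | no _ with j ≟ next i
...   | yes _ = a (next i) + 1
...   | no _ = a j

Valid : ∀ {q} → Config (suc q) → List (Fin (suc q)) → Set
Valid a [] = ⊤
Valid a (i ∷ is) = Allowed a i × Valid (move a i) is

run : ∀ {q} → Config (suc q) → List (Fin (suc q)) → Config (suc q)
run a [] = a
run a (i ∷ is) = run (move a i) is

Terminal : ∀ {q} → Config (suc q) → Set
Terminal a = ∀ i → a i ≤ a (next i)

conf : ∀ {q} → Config (suc q) → (ℕ → Fin (suc q)) → ℕ → Config (suc q)
conf a s zero = a
conf a s (suc m) = move (conf a s m) (s m)

sumℕ : ∀ {p} → Config p → ℕ
sumℕ {p} a = foldr _+_ 0 (map a (allFin p))

sumℤ : List ℤ → ℤ
sumℤ = foldr ℤ._+_ (+ 0)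

-- d_j(a,b) = Σ_{i=1}^{j} (a_i - b_i)  (player j is Fin index j-1).
d : ∀ {p} → Config p → Config p → Fin p → ℤ
d {p} a b j = sumℤ (map (λ i → + a i - + b i) (take (suc (toℕ j)) (allFin p)))

minFin : ∀ {q} → (Fin (suc q) → ℤ) → ℤ
minFin {zero} f = f Fin.zero
minFin {suc q} f = f Fin.zero ⊓ minFin (λ i → f (Fin.suc i))

sumFin : ∀ {p} → (Fin p → ℤ) → ℤ
sumFin {p} f = sumℤ (map f (allFin p))

constConfig : ∀ {p} → ℕ → Config p
constConfig k _ = k

-- Write D = d(·,P) for the current configuration and Φ = p·(−min D) + Σ D = Σ_j (D_j − min D).
-- A move at i < p lowers D_i by one; a move at p raises every D_j with j < p by one. In both
-- cases D_i was not minimal (otherwise a_i ≤ k ≤ a_{i+1}), so min D is shifted along with the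
-- untouched entries and Φ drops by exactly one. Φ ≥ 0, and Φ = 0 on a terminal configuration,
-- which must be constant, hence equal to P.
module Submission where

open import Defs
open import Data.Nat using (ℕ; suc; _*_)
open import Data.Integer using (ℤ; +_; -_; _+_)
import Data.Integer as ℤ
open import Data.Fin using (Fin)
open import Data.List using (List; length)
open import Data.Product using (_×_; ∃)
open import Relation.Nullary using (¬_)
open import Relation.Binary.PropositionalEquality using (_≡_)

import Data.Nat as ℕ
open import Data.Nat using (zero; z≤n; s≤s)
import Data.Nat.Properties as ℕP
open import Data.Nat.DivMod using (m<n⇒m%n≡m; n%n≡0)
open import Data.Integer using (_-_; _⊓_; ∣_∣)
import Data.Integer.Properties as ℤP
open import Data.Integer.Tactic.RingSolver using (solve-∀)
open import Algebra.Properties.CommutativeSemigroup ℤP.+-commutativeSemigroup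
  using (interchange; xy∙z≈xz∙y; x∙yz≈xz∙y)
open import Data.Fin using (zero; suc; toℕ; fromℕ; inject₁; _≟_)
import Data.Fin.Properties as FinP
open import Data.List using ([]; _∷_; map; take; foldr; tabulate; allFin)
import Data.List.Properties as ListP
open import Data.Product using (_,_; proj₂)
open import Data.Sum using (_⊎_; inj₁; inj₂)
open import Data.Bool using (if_then_else_)
open import Data.Empty using (⊥-elim)
open import Function using (_∘_)
open import Relation.Nullary using (does; yes; no)
open import Relation.Binary.PropositionalEquality
  using (refl; sym; trans; cong; cong₂; subst; _≢_; module ≡-Reasoning)

private
  variable
    A : Set
    n : ℕ

sumℤ-map-+ : (f g : A → ℤ) (xs : List A) →
  sumℤ (map (λ x → f x + g x) xs) ≡ sumℤ (map f xs) + sumℤ (map g xs)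
sumℤ-map-+ f g []       = refl
sumℤ-map-+ f g (x ∷ xs) =
  trans (cong (_+_ (f x + g x)) (sumℤ-map-+ f g xs)) (interchange (f x) (g x) _ _)

sumℤ-map-neg : (f : A → ℤ) (xs : List A) → sumℤ (map (λ x → - f x) xs) ≡ - sumℤ (map f xs)
sumℤ-map-neg f []       = refl
sumℤ-map-neg f (x ∷ xs) =
  trans (cong (_+_ (- f x)) (sumℤ-map-neg f xs)) (sym (ℤP.neg-distrib-+ (f x) _))

sumℤ-map-+-− : (f g h : A → ℤ) (xs : List A) →
  sumℤ (map (λ x → f x + (g x - h x)) xs) ≡
  sumℤ (map f xs) + (sumℤ (map g xs) - sumℤ (map h xs))
sumℤ-map-+-− f g h xs = begin
    sumℤ (map (λ x → f x + (g x - h x)) xs)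
  ≡⟨ sumℤ-map-+ f _ xs ⟩
    sumℤ (map f xs) + sumℤ (map (λ x → g x - h x) xs)
  ≡⟨ cong (_+_ (sumℤ (map f xs))) (sumℤ-map-+ g _ xs) ⟩
    sumℤ (map f xs) + (sumℤ (map g xs) + sumℤ (map (λ x → - h x) xs))
  ≡⟨ cong (λ t → sumℤ (map f xs) + (sumℤ (map g xs) + t)) (sumℤ-map-neg h xs) ⟩
    sumℤ (map f xs) + (sumℤ (map g xs) - sumℤ (map h xs)) ∎
  where open ≡-Reasoning

sumℤ-map-const : (c : ℤ) (xs : List A) → sumℤ (map (λ _ → c) xs) ≡ + length xs ℤ.* c
sumℤ-map-const c []       = sym (ℤP.*-zeroˡ c)
sumℤ-map-const c (x ∷ xs) =
  trans (cong (_+_ c) (sumℤ-map-const c xs)) (sym (ℤP.suc-* (+ length xs) c))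

sumℤ-map-≥ : (c : ℤ) (f : A → ℤ) → (∀ x → c ℤ.≤ f x) →
  (xs : List A) → + length xs ℤ.* c ℤ.≤ sumℤ (map f xs)
sumℤ-map-≥ c f c≤f []       = ℤP.≤-reflexive (ℤP.*-zeroˡ c)
sumℤ-map-≥ c f c≤f (x ∷ xs) = subst (ℤ._≤ _) (sym (ℤP.suc-* (+ length xs) c))
  (ℤP.+-mono-≤ (c≤f x) (sumℤ-map-≥ c f c≤f xs))

sumℤ-map-pos : (f : A → ℕ) (xs : List A) →
  sumℤ (map (λ x → + f x) xs) ≡ + foldr ℕ._+_ 0 (map f xs)
sumℤ-map-pos f []       = refl
sumℤ-map-pos f (x ∷ xs) = cong (_+_ (+ f x)) (sumℤ-map-pos f xs)

sumFin-cong : {f g : Fin n → ℤ} → (∀ i → f i ≡ g i) → sumFin f ≡ sumFin g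
sumFin-cong {n} f≗g = cong sumℤ (ListP.map-cong f≗g (allFin n))

length-allFin : ∀ n → length (allFin n) ≡ n
length-allFin n = ListP.length-tabulate (λ i → i)

sumFin-const : (c : ℤ) → sumFin {n} (λ _ → c) ≡ + n ℤ.* c
sumFin-const {n} c =
  trans (sumℤ-map-const c (allFin n)) (cong (λ m → + m ℤ.* c) (length-allFin n))

sumFin-≥ : (c : ℤ) (f : Fin n → ℤ) → (∀ i → c ℤ.≤ f i) → + n ℤ.* c ℤ.≤ sumFin f
sumFin-≥ {n} c f c≤f =
  subst (λ m → + m ℤ.* c ℤ.≤ sumFin f) (length-allFin n) (sumℤ-map-≥ c f c≤f (allFin n))

prefix : (Fin n → ℤ) → ℕ → ℤ
prefix {n} f m = sumℤ (map f (take m (allFin n)))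

prefix-all : (f : Fin n → ℤ) → prefix f n ≡ sumFin f
prefix-all {n} f =
  cong (sumℤ ∘ map f) (ListP.take-all n (allFin n) (ℕP.≤-reflexive (length-allFin n)))

prefix-suc : (f : Fin (suc n) → ℤ) (m : ℕ) → prefix f (suc m) ≡ f zero + prefix (f ∘ suc) m
prefix-suc {n} f m = cong (λ xs → f zero + sumℤ xs) (begin
    map f (take m (tabulate suc))
  ≡⟨ cong (map f ∘ take m) (sym (ListP.map-tabulate (λ i → i) suc)) ⟩
    map f (take m (map suc (allFin n)))
  ≡⟨ cong (map f) (ListP.take-map m (allFin n)) ⟩
    map f (map suc (take m (allFin n)))
  ≡⟨ sym (ListP.map-∘ (take m (allFin n))) ⟩
    map (f ∘ suc) (take m (allFin n)) ∎)
  where open ≡-Reasoning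

prefix-snoc : (f : Fin n → ℤ) (i : Fin n) → prefix f (suc (toℕ i)) ≡ prefix f (toℕ i) + f i
prefix-snoc f zero    = ℤP.+-comm (f zero) (+ 0)
prefix-snoc f (suc i) = begin
    prefix f (suc (suc (toℕ i)))
  ≡⟨ prefix-suc f (suc (toℕ i)) ⟩
    f zero + prefix (f ∘ suc) (suc (toℕ i))
  ≡⟨ cong (_+_ (f zero)) (prefix-snoc (f ∘ suc) i) ⟩
    f zero + (prefix (f ∘ suc) (toℕ i) + f (suc i))
  ≡⟨ sym (ℤP.+-assoc (f zero) _ _) ⟩
    (f zero + prefix (f ∘ suc) (toℕ i)) + f (suc i)
  ≡⟨ cong (_+ f (suc i)) (sym (prefix-suc f (toℕ i))) ⟩
    prefix f (suc (toℕ i)) + f (suc i) ∎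
  where open ≡-Reasoning

-- The comparison j ≟ i is the one made by `move`, so δ i j reduces in the same case splits.
δ : Fin n → Fin n → ℤ
δ i j = if does (j ≟ i) then + 1 else + 0

δ-≢ : {i j : Fin n} → j ≢ i → δ i j ≡ + 0
δ-≢ {i = i} {j} j≢i with j ≟ i
... | yes j≡i = ⊥-elim (j≢i j≡i)
... | no _    = refl

prefix-δ-before : (i : Fin n) (m : ℕ) → m ℕ.≤ toℕ i → prefix (δ i) m ≡ + 0
prefix-δ-before i       zero    _         = refl
prefix-δ-before (suc i) (suc m) (s≤s m≤i) =
  trans (prefix-suc (δ (suc i)) m) (trans (ℤP.+-identityˡ _) (prefix-δ-before i m m≤i))

prefix-δ-after : (i : Fin n) (m : ℕ) → toℕ i ℕ.< m → prefix (δ i) m ≡ + 1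
prefix-δ-after {suc n} zero (suc m) _ =
  trans (prefix-suc (δ zero) m)
        (cong (_+_ (+ 1)) (trans (sumℤ-map-const (+ 0) xs) (ℤP.*-zeroʳ (+ length xs))))
  where
  xs : List (Fin n)
  xs = take m (allFin n)
prefix-δ-after (suc i) (suc m) (s≤s i<m) =
  trans (prefix-suc (δ (suc i)) m) (trans (ℤP.+-identityˡ _) (prefix-δ-after i m i<m))

prefix-δ-upto : (i j : Fin n) → toℕ j ℕ.≤ toℕ i → prefix (δ i) (suc (toℕ j)) ≡ δ i j
prefix-δ-upto i j j≤i with j ≟ i
... | yes refl = prefix-δ-after i (suc (toℕ i)) ℕP.≤-refl
... | no j≢i   = prefix-δ-before i (suc (toℕ j)) (ℕP.≤∧≢⇒< j≤i (j≢i ∘ FinP.toℕ-injective))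

sumFin-δ : (i : Fin n) → sumFin (δ i) ≡ + 1
sumFin-δ {n} i = trans (sym (prefix-all (δ i))) (prefix-δ-after i n (FinP.toℕ<n i))

minFin-≤ : (f : Fin (suc n) → ℤ) (i : Fin (suc n)) → minFin f ℤ.≤ f i
minFin-≤ {zero}  f zero    = ℤP.≤-refl
minFin-≤ {suc n} f zero    = ℤP.i⊓j≤i _ _
minFin-≤ {suc n} f (suc i) = ℤP.≤-trans (ℤP.i⊓j≤j _ _) (minFin-≤ (f ∘ suc) i)

minFin-greatest : (f : Fin (suc n) → ℤ) {c : ℤ} → (∀ i → c ℤ.≤ f i) → c ℤ.≤ minFin f
minFin-greatest {zero}  f c≤f = c≤f zero
minFin-greatest {suc n} f c≤f = ℤP.⊓-glb (c≤f zero) (minFin-greatest (f ∘ suc) (c≤f ∘ suc))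

minFin-mono : {f g : Fin (suc n) → ℤ} → (∀ i → f i ℤ.≤ g i) → minFin f ℤ.≤ minFin g
minFin-mono {f = f} {g} f≤g = minFin-greatest g (λ i → ℤP.≤-trans (minFin-≤ f i) (f≤g i))

minFin-cong : {f g : Fin (suc n) → ℤ} → (∀ i → f i ≡ g i) → minFin f ≡ minFin g
minFin-cong f≗g = ℤP.≤-antisym (minFin-mono (ℤP.≤-reflexive ∘ f≗g))
                               (minFin-mono (ℤP.≤-reflexive ∘ sym ∘ f≗g))

minFin-+ : (f : Fin (suc n) → ℤ) (c : ℤ) → minFin (λ i → f i + c) ≡ minFin f + c
minFin-+ {zero}  f c = refl
minFin-+ {suc n} f c = trans (cong ((f zero + c) ⊓_) (minFin-+ (f ∘ suc) c))
  (sym (ℤP.mono-≤-distrib-⊓ {f = _+ c} (ℤP.+-monoˡ-≤ c) (f zero) _))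

minFin-lower-non-minimal : (f : Fin (suc n) → ℤ) (i : Fin (suc n)) → minFin f ℤ.< f i →
  minFin (λ j → f j - δ i j) ≡ minFin f
minFin-lower-non-minimal f i min<fi =
  ℤP.≤-antisym (minFin-mono lowered≤) (minFin-greatest _ min≤lowered)
  where
  lowered≤ : ∀ j → f j - δ i j ℤ.≤ f j
  lowered≤ j with j ≟ i
  ... | yes _ = ℤP.i≤j⇒i-k≤j (+ 1) ℤP.≤-refl
  ... | no _  = ℤP.i≤j⇒i-k≤j (+ 0) ℤP.≤-refl
  min≤lowered : ∀ j → minFin f ℤ.≤ f j - δ i j
  min≤lowered j with j ≟ i
  ... | yes refl = subst (minFin f ℤ.≤_) (ℤP.+-comm (- + 1) (f j)) (ℤP.i<j⇒i≤pred[j] min<fi)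
  ... | no _     = subst (minFin f ℤ.≤_) (sym (ℤP.+-identityʳ (f j))) (minFin-≤ f j)

potential : (Fin (suc n) → ℤ) → ℤ
potential {n} f = + suc n ℤ.* - minFin f + sumFin f

potential-nonneg : (f : Fin (suc n) → ℤ) → + 0 ℤ.≤ potential f
potential-nonneg {n} f = subst (ℤ._≤ potential f) (cancel (+ suc n) (minFin f))
  (ℤP.+-monoʳ-≤ (+ suc n ℤ.* - minFin f) (sumFin-≥ (minFin f) f (minFin-≤ f)))
  where
  cancel : ∀ P m → P ℤ.* - m + P ℤ.* m ≡ + 0
  cancel = solve-∀

potential-zero : (f : Fin (suc n) → ℤ) → (∀ i → f i ≡ + 0) → potential f ≡ + 0
potential-zero {n} f f≡0 =
  trans (cong₂ (λ m s → + suc n ℤ.* - m + s) min≡0 sum≡0)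
        (trans (ℤP.+-identityʳ _) (ℤP.*-zeroʳ (+ suc n)))
  where
  min≡0 : minFin f ≡ + 0
  min≡0 = ℤP.≤-antisym (subst (minFin f ℤ.≤_) (f≡0 zero) (minFin-≤ f zero))
                       (minFin-greatest f (ℤP.≤-reflexive ∘ sym ∘ f≡0))
  sum≡0 : sumFin f ≡ + 0
  sum≡0 = trans (sumFin-cong f≡0) (trans (sumFin-const {suc n} (+ 0)) (ℤP.*-zeroʳ (+ suc n)))

potential-drop : (f g : Fin (suc n) → ℤ) (i : Fin (suc n)) (c : ℤ) → minFin f ℤ.< f i →
  (∀ j → g j ≡ f j + (c - δ i j)) → potential g ≡ potential f - + 1
potential-drop {n} f g i c min<fi g≗ = begin
    + suc n ℤ.* - minFin g + sumFin g
  ≡⟨ cong₂ (λ m s → + suc n ℤ.* - m + s) min-g sum-g ⟩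
    + suc n ℤ.* - (minFin f + c) + (sumFin f + (+ suc n ℤ.* c - + 1))
  ≡⟨ rearrange (+ suc n) (minFin f) (sumFin f) c ⟩
    + suc n ℤ.* - minFin f + sumFin f - + 1 ∎
  where
  open ≡-Reasoning
  rearrange : ∀ P m s c → P ℤ.* - (m + c) + (s + (P ℤ.* c - + 1)) ≡ P ℤ.* - m + s - + 1
  rearrange = solve-∀
  min-g : minFin g ≡ minFin f + c
  min-g = trans (minFin-cong (λ j → trans (g≗ j) (x∙yz≈xz∙y (f j) c (- δ i j))))
                (trans (minFin-+ (λ j → f j - δ i j) c) (cong (_+ c) (minFin-lower-non-minimal f i min<fi)))
  sum-g : sumFin g ≡ sumFin f + (+ suc n ℤ.* c - + 1)
  sum-g = trans (sumFin-cong g≗)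
    (trans (sumℤ-map-+-− f (λ _ → c) (δ i) (allFin (suc n)))
           (cong₂ (λ s t → sumFin f + (s - t)) (sumFin-const {suc n} c) (sumFin-δ i)))

next-inject₁ : (i : Fin n) → next (inject₁ i) ≡ suc i
next-inject₁ {n} i = FinP.toℕ-injective (begin
    toℕ (next (inject₁ i))
  ≡⟨ FinP.toℕ-fromℕ< _ ⟩
    suc (toℕ (inject₁ i)) ℕ.% suc n
  ≡⟨ cong (λ m → suc m ℕ.% suc n) (FinP.toℕ-inject₁ i) ⟩
    suc (toℕ i) ℕ.% suc n
  ≡⟨ m<n⇒m%n≡m (s≤s (FinP.toℕ<n i)) ⟩
    suc (toℕ i) ∎)
  where open ≡-Reasoning

next-fromℕ : next (fromℕ n) ≡ zero
next-fromℕ {n} = FinP.toℕ-injective (begin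
    toℕ (next (fromℕ n))
  ≡⟨ FinP.toℕ-fromℕ< _ ⟩
    suc (toℕ (fromℕ n)) ℕ.% suc n
  ≡⟨ cong (λ m → suc m ℕ.% suc n) (FinP.toℕ-fromℕ n) ⟩
    suc n ℕ.% suc n
  ≡⟨ n%n≡0 (suc n) ⟩
    0 ∎)
  where open ≡-Reasoning

next-surjective : (i : Fin (suc n)) → ∃ λ j → next j ≡ i
next-surjective zero    = fromℕ _ , next-fromℕ
next-surjective (suc i) = inject₁ i , next-inject₁ i

fromℕ-or-inject₁ : (i : Fin (suc n)) → i ≡ fromℕ n ⊎ ∃ λ j → i ≡ inject₁ j
fromℕ-or-inject₁ {zero}  zero    = inj₁ refl
fromℕ-or-inject₁ {suc n} zero    = inj₂ (zero , refl)
fromℕ-or-inject₁ {suc n} (suc i) with fromℕ-or-inject₁ i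
... | inj₁ refl       = inj₁ refl
... | inj₂ (j , refl) = inj₂ (suc j , refl)

ascending⇒zero≤ : (f : Fin (suc n) → ℕ) → (∀ i → f (inject₁ i) ℕ.≤ f (suc i)) →
  ∀ i → f zero ℕ.≤ f i
ascending⇒zero≤         f asc zero    = ℕP.≤-refl
ascending⇒zero≤ {suc n} f asc (suc i) =
  ℕP.≤-trans (asc zero) (ascending⇒zero≤ (f ∘ suc) (asc ∘ suc) i)

ascending⇒≤fromℕ : (f : Fin (suc n) → ℕ) → (∀ i → f (inject₁ i) ℕ.≤ f (suc i)) →
  ∀ i → f i ℕ.≤ f (fromℕ n)
ascending⇒≤fromℕ {zero}  f asc zero    = ℕP.≤-refl
ascending⇒≤fromℕ {suc n} f asc zero    =
  ℕP.≤-trans (asc zero) (ascending⇒≤fromℕ (f ∘ suc) (asc ∘ suc) zero)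
ascending⇒≤fromℕ {suc n} f asc (suc i) = ascending⇒≤fromℕ (f ∘ suc) (asc ∘ suc) i

terminal⇒constant : (a : Config (suc n)) → Terminal a → ∀ i → a i ≡ a zero
terminal⇒constant {n} a end i = ℕP.≤-antisym
  (ℕP.≤-trans (ascending⇒≤fromℕ a asc i)
              (subst (λ j → a (fromℕ n) ℕ.≤ a j) next-fromℕ (end (fromℕ n))))
  (ascending⇒zero≤ a asc i)
  where
  asc : ∀ j → a (inject₁ j) ℕ.≤ a (suc j)
  asc j = subst (λ j⁺ → a (inject₁ j) ℕ.≤ a j⁺) (next-inject₁ j) (end (inject₁ j))

allowed⇒next≢ : {a : Config (suc n)} {i : Fin (suc n)} → Allowed a i → next i ≢ i
allowed⇒next≢ {a = a} al next≡i = ℕP.<-irrefl (cong a next≡i) al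

¬countdown-nonneg : (x : ℤ) → ¬ (∀ m → + 0 ℤ.≤ x - + m)
¬countdown-nonneg x nonneg = negative (subst (+ 0 ℤ.≤_) (one-below (+ ∣x∣)) 0≤∣x∣-[1+∣x∣])
  where
  ∣x∣ : ℕ
  ∣x∣ = ∣ x ∣
  x≡∣x∣ : x ≡ + ∣x∣
  x≡∣x∣ = sym (ℤP.0≤i⇒+∣i∣≡i (subst (+ 0 ℤ.≤_) (ℤP.+-identityʳ x) (nonneg 0)))
  0≤∣x∣-[1+∣x∣] : + 0 ℤ.≤ + ∣x∣ - + suc ∣x∣
  0≤∣x∣-[1+∣x∣] = subst (λ y → + 0 ℤ.≤ y - + suc ∣x∣) x≡∣x∣ (nonneg (suc ∣x∣))
  one-below : ∀ y → y - (+ 1 + y) ≡ - + 1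
  one-below = solve-∀
  negative : ¬ (+ 0 ℤ.≤ - + 1)
  negative ()

module _ (k : ℕ) {q : ℕ} where

  surplus : Config (suc q) → Fin (suc q) → ℤ
  surplus a i = + a i - + k

  dₖ : Config (suc q) → Fin (suc q) → ℤ
  dₖ a = d a (constConfig k)

  Balanced : Config (suc q) → Set
  Balanced a = sumFin (surplus a) ≡ + 0

  balanced-init : (a : Config (suc q)) → sumℕ a ≡ k * suc q → Balanced a
  balanced-init a total = begin
      sumFin (surplus a)
    ≡⟨ sumℤ-map-+ (λ i → + a i) (λ _ → - + k) (allFin (suc q)) ⟩
      sumℤ (map (λ i → + a i) (allFin (suc q))) + sumFin {suc q} (λ _ → - + k)
    ≡⟨ cong₂ _+_ (sumℤ-map-pos a (allFin (suc q))) (sumFin-const {suc q} (- + k)) ⟩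
      + sumℕ a + + suc q ℤ.* - + k
    ≡⟨ cong (λ t → + t + + suc q ℤ.* - + k) total ⟩
      + (k * suc q) + + suc q ℤ.* - + k
    ≡⟨ cong (_+ + suc q ℤ.* - + k) (ℤP.pos-* k (suc q)) ⟩
      + k ℤ.* + suc q + + suc q ℤ.* - + k
    ≡⟨ cancel (+ k) (+ suc q) ⟩
      + 0 ∎
    where
    open ≡-Reasoning
    cancel : ∀ K P → K ℤ.* P + P ℤ.* - K ≡ + 0
    cancel = solve-∀

  surplus-move : (a : Config (suc q)) (i : Fin (suc q)) → Allowed a i →
    ∀ j → surplus (move a i) j ≡ surplus a j + (δ (next i) j - δ i j)
  surplus-move a i al j with j ≟ i
  ... | yes refl with i ≟ next i
  ...   | yes i≡next = ⊥-elim (allowed⇒next≢ {a = a} al (sym i≡next))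
  ...   | no _       = trans (cong (_- + k) (sym (ℤP.⊖-≥ (ℕP.≤-trans (s≤s z≤n) al))))
                             (xy∙z≈xz∙y (+ a i) (- + 1) (- + k))
  surplus-move a i al j | no _ with j ≟ next i
  ... | yes refl = trans (cong (_- + k) (ℤP.pos-+ (a j) 1)) (xy∙z≈xz∙y (+ a j) (+ 1) (- + k))
  ... | no _     = sym (ℤP.+-identityʳ _)

  balanced-move : (a : Config (suc q)) (i : Fin (suc q)) → Allowed a i →
    Balanced a → Balanced (move a i)
  balanced-move a i al bal = begin
      sumFin (surplus (move a i))
    ≡⟨ sumFin-cong (surplus-move a i al) ⟩
      sumFin (λ j → surplus a j + (δ (next i) j - δ i j))
    ≡⟨ sumℤ-map-+-− (surplus a) (δ (next i)) (δ i) (allFin (suc q)) ⟩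
      sumFin (surplus a) + (sumFin (δ (next i)) - sumFin (δ i))
    ≡⟨ cong₂ (λ s t → s + (t - sumFin (δ i))) bal (sumFin-δ (next i)) ⟩
      + 0 + (+ 1 - sumFin (δ i))
    ≡⟨ cong (λ t → + 0 + (+ 1 - t)) (sumFin-δ i) ⟩
      + 0 ∎
    where open ≡-Reasoning

  dₖ-move : (a : Config (suc q)) (i : Fin (suc q)) → Allowed a i → ∀ {i⁺} → next i ≡ i⁺ →
    ∀ j → dₖ (move a i) j ≡
          dₖ a j + (prefix (δ i⁺) (suc (toℕ j)) - prefix (δ i) (suc (toℕ j)))
  dₖ-move a i al refl j =
    trans (cong sumℤ (ListP.map-cong (surplus-move a i al) xs))
          (sumℤ-map-+-− (surplus a) (δ (next i)) (δ i) xs)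
    where
    xs : List (Fin (suc q))
    xs = take (suc (toℕ j)) (allFin (suc q))

  dₖ-move-shape : (a : Config (suc q)) (i : Fin (suc q)) → Allowed a i →
    ∃ λ c → ∀ j → dₖ (move a i) j ≡ dₖ a j + (c - δ i j)
  dₖ-move-shape a i al with fromℕ-or-inject₁ i
  ... | inj₁ refl = + 1 , λ j →
    trans (dₖ-move a i al next-fromℕ j) (cong (_+_ (dₖ a j))
      (cong₂ _-_ (prefix-δ-after zero (suc (toℕ j)) (s≤s z≤n)) (prefix-δ-upto i j (FinP.≤fromℕ j))))
  ... | inj₂ (i′ , refl) = + 0 , λ j →
    trans (dₖ-move a i al (next-inject₁ i′) j) (cong (_+_ (dₖ a j)) (prefix-difference j))
    where
    prefix-difference : ∀ j →
      prefix (δ (suc i′)) (suc (toℕ j)) - prefix (δ i) (suc (toℕ j)) ≡ + 0 - δ i j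
    prefix-difference j with ℕP.≤-<-connex (toℕ j) (toℕ i′)
    ... | inj₁ j≤i′ = cong₂ _-_ (prefix-δ-before (suc i′) _ (s≤s j≤i′))
      (prefix-δ-upto i j (subst (toℕ j ℕ.≤_) (sym (FinP.toℕ-inject₁ i′)) j≤i′))
    ... | inj₂ i′<j = begin
        prefix (δ (suc i′)) (suc (toℕ j)) - prefix (δ i) (suc (toℕ j))
      ≡⟨ cong₂ _-_ (prefix-δ-after (suc i′) _ (s≤s i′<j))
           (prefix-δ-after i _ (ℕP.≤-trans (s≤s (ℕP.≤-reflexive (FinP.toℕ-inject₁ i′)))
                                            (ℕP.m≤n⇒m≤1+n i′<j))) ⟩
        + 0
      ≡⟨ cong (_-_ (+ 0)) (sym (δ-≢ j≢i)) ⟩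
        + 0 - δ i j ∎
      where
      open ≡-Reasoning
      j≢i : j ≢ i
      j≢i j≡i = ℕP.<-irrefl (trans (sym (FinP.toℕ-inject₁ i′)) (cong toℕ (sym j≡i))) i′<j

  dₖ-fromℕ : (a : Config (suc q)) → dₖ a (fromℕ q) ≡ sumFin (surplus a)
  dₖ-fromℕ a = trans (cong (prefix (surplus a) ∘ suc) (FinP.toℕ-fromℕ q)) (prefix-all (surplus a))

  -- Balance (d_p = 0) is what makes this hold across the wrap-around from player p to player 1.
  dₖ-successor : (a : Config (suc q)) → Balanced a → ∀ {i j} → next i ≡ j →
    surplus a j ≡ dₖ a j - dₖ a i
  dₖ-successor a bal {i} {j} i→j =
    trans (sym (cancel (dₖ a i) (surplus a j))) (cong (_- dₖ a i) (sym (additive i i→j)))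
    where
    cancel : ∀ x s → x + s - x ≡ s
    cancel = solve-∀
    additive : ∀ i → next i ≡ j → dₖ a j ≡ dₖ a i + surplus a j
    additive i i→j with fromℕ-or-inject₁ i
    ... | inj₁ refl with trans (sym i→j) next-fromℕ
    ...   | refl = trans (ℤP.+-comm (surplus a zero) (+ 0))
                         (cong (_+ surplus a zero) (sym (trans (dₖ-fromℕ a) bal)))
    additive i i→j | inj₂ (i′ , refl) with trans (sym i→j) (next-inject₁ i′)
    ...   | refl = trans (prefix-snoc (surplus a) (suc i′))
                   (cong (λ m → prefix (surplus a) (suc m) + surplus a (suc i′))
                         (sym (FinP.toℕ-inject₁ i′)))

  allowed⇒above-minimum : (a : Config (suc q)) (i : Fin (suc q)) → Balanced a → Allowed a i →
    minFin (dₖ a) ℤ.< dₖ a i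
  allowed⇒above-minimum a i bal al with minFin (dₖ a) ℤP.<? dₖ a i
  ... | yes min<dᵢ = min<dᵢ
  ... | no min≮dᵢ  = ⊥-elim (ℕP.<⇒≱ al (ℤP.drop‿+≤+ (ℤP.≤-trans aᵢ≤k k≤aᵢ₊₁)))
    where
    dᵢ-minimal : ∀ j → dₖ a i ℤ.≤ dₖ a j
    dᵢ-minimal j = ℤP.≤-trans (ℤP.≮⇒≥ min≮dᵢ) (minFin-≤ (dₖ a) j)
    aᵢ≤k : + a i ℤ.≤ + k
    aᵢ≤k with next-surjective i
    ... | j , j→i = ℤP.i-j≤0⇒i≤j (subst (ℤ._≤ + 0) (sym (dₖ-successor a bal j→i))
                                        (ℤP.i≤j⇒i-j≤0 (dᵢ-minimal j)))
    k≤aᵢ₊₁ : + k ℤ.≤ + a (next i)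
    k≤aᵢ₊₁ = ℤP.0≤i-j⇒j≤i (subst (+ 0 ℤ.≤_) (sym (dₖ-successor a bal {i} refl))
                                 (ℤP.i≤j⇒0≤j-i (dᵢ-minimal (next i))))

  move-step : (a : Config (suc q)) (i : Fin (suc q)) → Balanced a → Allowed a i →
    Balanced (move a i) × potential (dₖ (move a i)) ≡ potential (dₖ a) - + 1
  move-step a i bal al with dₖ-move-shape a i al
  ... | c , shape = balanced-move a i al bal
                  , potential-drop (dₖ a) (dₖ (move a i)) i c (allowed⇒above-minimum a i bal al) shape

  terminal⇒dₖ≡0 : (a : Config (suc q)) → Balanced a → Terminal a → ∀ j → dₖ a j ≡ + 0
  terminal⇒dₖ≡0 a bal end j =
    trans (cong sumℤ (ListP.map-cong surplus≡0 xs))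
          (trans (sumℤ-map-const (+ 0) xs) (ℤP.*-zeroʳ (+ length xs)))
    where
    xs : List (Fin (suc q))
    xs = take (suc (toℕ j)) (allFin (suc q))
    e : ℤ
    e = surplus a zero
    flat : ∀ t → surplus a t ≡ e
    flat t = cong (λ m → + m - + k) (terminal⇒constant a end t)
    e≡0 : e ≡ + 0
    e≡0 = ℤP.*-cancelˡ-≡ (+ suc q) e (+ 0) (begin
        + suc q ℤ.* e       ≡⟨ sym (trans (sumFin-cong flat) (sumFin-const {suc q} e)) ⟩
        sumFin (surplus a)  ≡⟨ bal ⟩
        + 0                 ≡⟨ sym (ℤP.*-zeroʳ (+ suc q)) ⟩
        + suc q ℤ.* + 0     ∎)
      where open ≡-Reasoning
    surplus≡0 : ∀ t → surplus a t ≡ + 0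
    surplus≡0 t = trans (flat t) e≡0

  length-run : (a : Config (suc q)) (ms : List (Fin (suc q))) → Balanced a → Valid a ms →
    Terminal (run a ms) → + length ms ≡ potential (dₖ a)
  length-run a []       bal _           end = sym (potential-zero (dₖ a) (terminal⇒dₖ≡0 a bal end))
  length-run a (i ∷ ms) bal (al , valid) end with move-step a i bal al
  ... | bal′ , drop = begin
      + 1 + + length ms
    ≡⟨ cong (_+_ (+ 1)) (length-run (move a i) ms bal′ valid end) ⟩
      + 1 + potential (dₖ (move a i))
    ≡⟨ cong (_+_ (+ 1)) drop ⟩
      + 1 + (potential (dₖ a) - + 1)
    ≡⟨ cancel (potential (dₖ a)) ⟩
      potential (dₖ a) ∎
    where
    open ≡-Reasoning
    cancel : ∀ x → + 1 + (x - + 1) ≡ x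
    cancel = solve-∀

  potential-conf : (a : Config (suc q)) (s : ℕ → Fin (suc q)) → (∀ m → Allowed (conf a s m) (s m)) →
    Balanced a → ∀ m → Balanced (conf a s m) × potential (dₖ (conf a s m)) ≡ potential (dₖ a) - + m
  potential-conf a s allowed bal zero    = bal , sym (ℤP.+-identityʳ _)
  potential-conf a s allowed bal (suc m) with potential-conf a s allowed bal m
  ... | bal′ , eq with move-step (conf a s m) (s m) bal′ (allowed m)
  ...   | bal″ , drop = bal″ , trans drop (trans (cong (_- + 1) eq) (regroup (potential (dₖ a)) (+ m)))
    where
    regroup : ∀ x y → x - y - + 1 ≡ x - (+ 1 + y)
    regroup = solve-∀

  no-infinite-play : (a : Config (suc q)) → Balanced a →
    ¬ (∃ λ (s : ℕ → Fin (suc q)) → (m : ℕ) → Allowed (conf a s m) (s m))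
  no-infinite-play a bal (s , allowed) = ¬countdown-nonneg (potential (dₖ a)) λ m →
    subst (+ 0 ℤ.≤_) (proj₂ (potential-conf a s allowed bal m)) (potential-nonneg (dₖ (conf a s m)))

corollary3 : (q k : ℕ) → (O : Config (suc q)) → sumℕ O ≡ k * suc q →
    (¬ (∃ λ (s : ℕ → Fin (suc q)) → (m : ℕ) → Allowed (conf O s m) (s m)))
    × ((ms : List (Fin (suc q))) → Valid O ms → Terminal (run O ms) →
        + length ms ≡ (+ suc q) ℤ.* (- minFin (d O (constConfig k))) + sumFin (d O (constConfig k)))
corollary3 q k O total =
  no-infinite-play k O balanced , λ ms valid end → length-run k O ms balanced valid end
  where
  balanced : Balanced k O
  balanced = balanced-init k O total
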